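{- Let $q$ be a prime power and $a,b,d,d_1,d_2,u$ positive integers with $2d\le d_1+d_2$. Then $\Lambda(q,a,b,d,u)\ge\min\{A_q(a,d_1;u),A_q(b,d_2;u)\}$.
   Context: $\Lambda(q,a,b,d,u)$ is the maximum size of a set of $a\times b$ matrices over $\mathbb{F}_q$ such that any two distinct elements $X,Y$ satisfy $\mathrm{rk}(X-Y)\ge d$ and every element has rank at most $u$. $A_q(v,d;k)$ is the maximum number of $k$-dimensional subspaces of $\mathbb{F}_q^v$ with pairwise subspace distance $\dim(U+W)-\dim(U\cap W)$ at least $d$. -}

module Defs where

open import Level using (0ℓ)
open import Data.Nat as ℕ using (ℕ; zero; suc; _≤_)
open import Data.Nat.Primality using (Prime)
open import Data.Fin using (Fin; zero; suc; _↑ˡ_; _↑ʳ_; splitAt)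
open import Data.Sum using (inj₁; inj₂)
open import Data.Product using (Σ; ∃; ∃-syntax; _×_; _,_)
open import Relation.Binary.PropositionalEquality using (_≡_; _≢_)
open import Relation.Nullary using (¬_)
open import Function.Bundles using (_↔_)
open import Function.Definitions using (Injective)
open import Algebra.Structures using (IsCommutativeRing)

IsPrimePower : ℕ → Set
IsPrimePower q = ∃[ p ] ∃[ k ] (Prime p × 1 ≤ k × q ≡ p ℕ.^ k)

record FiniteField (q : ℕ) : Set₁ where
  infixl 6 _+_
  infixl 7 _*_
  field
    Carrier : Set
    _+_ _*_ : Carrier → Carrier → Carrier
    -_ : Carrier → Carrier
    0# 1# : Carrier
    isCommutativeRing : IsCommutativeRing _≡_ _+_ _*_ -_ 0# 1#
    0≢1 : 0# ≢ 1#
    inverse : ∀ x → x ≢ 0# → ∃[ y ] (x * y ≡ 1#)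
    enumeration : Carrier ↔ Fin q

module _ {q : ℕ} (F : FiniteField q) where
  open FiniteField F

  ∑ : ∀ {n} → (Fin n → Carrier) → Carrier
  ∑ {zero} f = 0#
  ∑ {suc n} f = f zero + ∑ (λ i → f (suc i))

  Vector : ℕ → Set
  Vector n = Fin n → Carrier

  Matrix : ℕ → ℕ → Set
  Matrix m n = Fin m → Fin n → Carrier

  _-ᴹ_ : ∀ {m n} → Matrix m n → Matrix m n → Matrix m n
  (X -ᴹ Y) i j = X i j + (- (Y i j))

  LinearlyIndependent : ∀ {k n} → (Fin k → Vector n) → Set
  LinearlyIndependent {k} {n} v =
    (c : Fin k → Carrier) →
    (∀ j → ∑ (λ i → c i * v i j) ≡ 0#) → ∀ i → c i ≡ 0#

  RankAtLeast : ∀ {m n} → Matrix m n → ℕ → Set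
  RankAtLeast {m} M r =
    ∃[ σ ] (Injective _≡_ _≡_ σ × LinearlyIndependent (λ (i : Fin r) → M (σ i)))

  RankAtMost : ∀ {m n} → Matrix m n → ℕ → Set
  RankAtMost M u = ¬ RankAtLeast M (suc u)

  -- Rank-metric codes: n matrices X_0..X_{n-1} of size a×b, pairwise
  -- rk(X_i - X_j) ≥ d for i ≠ j, each of rank ≤ u.
  -- (Since d ≥ 1 the X_i are automatically distinct, so the code has n elements.)
  RankMetricCode : (a b d u n : ℕ) → Set
  RankMetricCode a b d u n =
    Σ (Fin n → Matrix a b) λ X →
      (∀ i j → i ≢ j → RankAtLeast (X i -ᴹ X j) d) × (∀ i → RankAtMost (X i) u)

  -- Subspaces of F^v of dimension k, given by a k×v generator matrix of
  -- rank k (the subspace is its row space).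
  Subspace : (v k : ℕ) → Set
  Subspace v k = Σ (Matrix k v) λ G → RankAtLeast G k

  -- stacking two generator matrices: its row space is U + W
  stack : ∀ {k l v} → Matrix k v → Matrix l v → Matrix (k ℕ.+ l) v
  stack {k} G H i with splitAt k i
  ... | inj₁ i' = G i'
  ... | inj₂ i' = H i'

  SumDimAtLeast : ∀ {v k} → Subspace v k → Subspace v k → ℕ → Set
  SumDimAtLeast (G , _) (H , _) s = RankAtLeast (stack G H) s

  -- subspace distance dim(U+W) - dim(U∩W) ≥ d, where for k-dim U,W
  -- dim(U∩W) = 2k - dim(U+W), so the distance is 2 dim(U+W) - 2k.
  SubspaceDistAtLeast : ∀ {v k} → Subspace v k → Subspace v k → ℕ → Set
  SubspaceDistAtLeast {v} {k} U W d =
    ∃[ s ] (SumDimAtLeast U W s × d ℕ.+ 2 ℕ.* k ≤ 2 ℕ.* s)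

  -- constant-dimension codes: n k-dim subspaces of F^v, pairwise distance ≥ d
  -- for i ≠ j (with d ≥ 1 these are automatically distinct subspaces).
  ConstantDimCode : (v d k n : ℕ) → Set
  ConstantDimCode v d k n =
    Σ (Fin n → Subspace v k) λ U →
      ∀ i j → i ≢ j → SubspaceDistAtLeast (U i) (U j) d

-- Write U i and W i as the row spaces of u × a and u × b matrices G i and H i, and take
-- X i = G iᵀ H i. Then rk X i ≤ u, and X i − X j = [G i ; −G j]ᵀ [H i ; H j] is a product over
-- 2u inner indices whose factors have ranks s₁ = dim(U i + U j) and s₂ = dim(W i + W j).
-- Sylvester's inequality rk(AᵀB) ≥ rk A + rk B − 2u gives rk(X i − X j) ≥ s₁ + s₂ − 2u, which is
-- at least (d₁ + d₂)/2 ≥ d because the subspace distances say 2s₁ − 2u ≥ d₁ and 2s₂ − 2u ≥ d₂.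
-- Both rank bounds reduce to the Steinitz exchange lemma; finiteness of the field makes spans
-- decidable, so bases of row and column spaces can be extracted constructively.

module Submission where

open import Defs
open import Level using (0ℓ)
open import Data.Nat as ℕ using (ℕ; zero; suc; _≤_; z≤n; s≤s)
import Data.Nat.Properties as ℕ
open import Data.Fin as Fin using (Fin; zero; suc; _↑ˡ_; _↑ʳ_; splitAt; punchIn)
import Data.Fin.Properties as Fin
open import Data.Sum using (inj₁; inj₂; [_,_])
open import Data.Product using (Σ; ∃; _×_; _,_; proj₁; proj₂)
open import Data.Vec.Functional using (_++_; _∷_; insertAt; transpose)
open import Data.Vec.Functional.Properties
  using (lookup-++ˡ; lookup-++ʳ; ++-cong; insertAt-lookup; insertAt-punchIn)
open import Data.Vec.Functional.Relation.Unary.All.Properties using (++⁺)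
open import Data.Empty using (⊥-elim)
open import Relation.Nullary using (¬_; Dec; yes; no)
open import Relation.Nullary.Decidable using (via-injection; map′)
open import Relation.Unary using (Decidable)
open import Relation.Binary.Definitions using (DecidableEquality; _Respects_)
open import Relation.Binary.PropositionalEquality hiding ([_])
open import Function using (_∘_)
open import Function.Bundles using (Inverse)
open import Function.Definitions using (Injective)
open import Function.Properties.Inverse using (↔⇒↣)
open import Algebra.Bundles using (CommutativeRing)
import Algebra.Properties.CommutativeSemigroup as CommutativeSemigroupProperties
import Algebra.Properties.Ring as RingProperties
import Algebra.Properties.Semiring.Sum as SemiringSum

↑-elim : ∀ {m n} {P : Fin (m ℕ.+ n) → Set} →
         (∀ i → P (i ↑ˡ n)) → (∀ j → P (m ↑ʳ j)) → ∀ k → P k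
↑-elim {m} {n} {P} left right k =
  subst P (Fin.join-splitAt m n k) ([_,_] {C = P ∘ Fin.join m n} left right (splitAt m k))

distance-bound : ∀ d d₁ d₂ u s₁ s₂ → 2 ℕ.* d ≤ d₁ ℕ.+ d₂ →
                 d₁ ℕ.+ 2 ℕ.* u ≤ 2 ℕ.* s₁ → d₂ ℕ.+ 2 ℕ.* u ≤ 2 ℕ.* s₂ → d ℕ.+ (u ℕ.+ u) ≤ s₁ ℕ.+ s₂
distance-bound d d₁ d₂ u s₁ s₂ 2d≤d₁+d₂ bound₁ bound₂ = ℕ.*-cancelˡ-≤ 2 (begin
  2 ℕ.* (d ℕ.+ (u ℕ.+ u))                   ≡⟨ ℕ.*-distribˡ-+ 2 d (u ℕ.+ u) ⟩
  2 ℕ.* d ℕ.+ 2 ℕ.* (u ℕ.+ u)               ≡⟨ cong (2 ℕ.* d ℕ.+_) (ℕ.*-distribˡ-+ 2 u u) ⟩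
  2 ℕ.* d ℕ.+ (2 ℕ.* u ℕ.+ 2 ℕ.* u)         ≤⟨ ℕ.+-monoˡ-≤ _ 2d≤d₁+d₂ ⟩
  d₁ ℕ.+ d₂ ℕ.+ (2 ℕ.* u ℕ.+ 2 ℕ.* u)       ≡⟨ interchange d₁ d₂ (2 ℕ.* u) (2 ℕ.* u) ⟩
  d₁ ℕ.+ 2 ℕ.* u ℕ.+ (d₂ ℕ.+ 2 ℕ.* u)       ≤⟨ ℕ.+-mono-≤ bound₁ bound₂ ⟩
  2 ℕ.* s₁ ℕ.+ 2 ℕ.* s₂                     ≡⟨ ℕ.*-distribˡ-+ 2 s₁ s₂ ⟨
  2 ℕ.* (s₁ ℕ.+ s₂)                         ∎)
  where
  open ℕ.≤-Reasoning
  open CommutativeSemigroupProperties ℕ.+-commutativeSemigroup using (interchange)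

module LinearAlgebra {q : ℕ} (F : FiniteField q) where
  open FiniteField F

  commutativeRing : CommutativeRing 0ℓ 0ℓ
  commutativeRing = record { isCommutativeRing = isCommutativeRing }

  open CommutativeRing commutativeRing
    using (+-assoc; +-comm; +-identityˡ; +-identityʳ; -‿inverseʳ;
           *-assoc; *-comm; *-identityˡ; *-identityʳ; distribˡ; distribʳ; zeroˡ; zeroʳ; ring; semiring)
  open RingProperties ring using (-‿distribˡ-*; -‿distribʳ-*; -‿involutive; -‿+-comm; -0#≈0#; +-inverseˡ-unique)
  open SemiringSum semiring using (sum; sum-cong-≗; sum-replicate-zero; ∑-distrib-+; ∑-comm; sum-remove;
                                   *-distribˡ-sum; *-distribʳ-sum)

  _≟_ : DecidableEquality Carrier
  _≟_ = via-injection (↔⇒↣ enumeration) Fin._≟_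

  ∃-Carrier? : ∀ {P : Carrier → Set} → Decidable P → Dec (∃ P)
  ∃-Carrier? {P} P? = map′ (λ (i , p) → from i , p)
                           (λ (x , p) → to x , subst P (sym (strictlyInverseʳ x)) p)
                           (Fin.any? (P? ∘ from))
    where open Inverse enumeration

  ∃-Vector? : ∀ n {P : Vector F n → Set} → P Respects _≗_ → Decidable P → Dec (∃ P)
  ∃-Vector? zero    P-resp P? = map′ (λ p → _ , p) (λ (c , p) → P-resp (λ ()) p) (P? (λ ()))
  ∃-Vector? (suc n) P-resp P? =
    map′ (λ (x , c , p) → x ∷ c , p)
         (λ (c , p) → c zero , (c ∘ suc) , P-resp (λ { zero → refl ; (suc i) → refl }) p)
         (∃-Carrier? λ x → ∃-Vector? n (λ c≗c′ → P-resp λ { zero → refl ; (suc i) → c≗c′ i })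
                                         (λ c → P? (x ∷ c)))

  ∑≡sum : ∀ {n} (f : Vector F n) → ∑ F f ≡ sum f
  ∑≡sum {zero}  f = refl
  ∑≡sum {suc n} f = cong (f zero +_) (∑≡sum (f ∘ suc))

  ∑-cong : ∀ {n} {f g : Vector F n} → f ≗ g → ∑ F f ≡ ∑ F g
  ∑-cong {f = f} {g} f≗g rewrite ∑≡sum f | ∑≡sum g = sum-cong-≗ f≗g

  ∑-zero : ∀ n → ∑ F {n} (λ _ → 0#) ≡ 0#
  ∑-zero n rewrite ∑≡sum {n} (λ _ → 0#) = sum-replicate-zero n

  ∑-+ : ∀ {n} (f g : Vector F n) → ∑ F (λ i → f i + g i) ≡ ∑ F f + ∑ F g
  ∑-+ f g rewrite ∑≡sum (λ i → f i + g i) | ∑≡sum f | ∑≡sum g = ∑-distrib-+ f g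

  *-∑ : ∀ {n} x (f : Vector F n) → x * ∑ F f ≡ ∑ F (λ i → x * f i)
  *-∑ x f rewrite ∑≡sum f | ∑≡sum (λ i → x * f i) = *-distribˡ-sum x f

  ∑-* : ∀ {n} x (f : Vector F n) → ∑ F f * x ≡ ∑ F (λ i → f i * x)
  ∑-* x f rewrite ∑≡sum f | ∑≡sum (λ i → f i * x) = *-distribʳ-sum x f

  ∑-∑-comm : ∀ {m n} (f : Fin m → Fin n → Carrier) →
             ∑ F (λ i → ∑ F (f i)) ≡ ∑ F (λ j → ∑ F (λ i → f i j))
  ∑-∑-comm f = begin
    ∑ F (λ i → ∑ F (f i))              ≡⟨ ∑-cong (λ i → ∑≡sum (f i)) ⟩
    ∑ F (λ i → sum (f i))              ≡⟨ ∑≡sum (λ i → sum (f i)) ⟩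
    sum (λ i → sum (f i))              ≡⟨ ∑-comm f ⟩
    sum (λ j → sum (λ i → f i j))      ≡⟨ ∑≡sum (λ j → sum (λ i → f i j)) ⟨
    ∑ F (λ j → sum (λ i → f i j))      ≡⟨ ∑-cong (λ j → ∑≡sum (λ i → f i j)) ⟨
    ∑ F (λ j → ∑ F (λ i → f i j))      ∎
    where open ≡-Reasoning

  ∑-punchIn : ∀ {n} (i : Fin (suc n)) (f : Vector F (suc n)) → ∑ F f ≡ f i + ∑ F (f ∘ punchIn i)
  ∑-punchIn i f rewrite ∑≡sum f | ∑≡sum (f ∘ punchIn i) = sum-remove {i = i} f

  ∑-neg : ∀ {n} (f : Vector F n) → ∑ F (λ i → - f i) ≡ - ∑ F f
  ∑-neg {zero}  f = sym -0#≈0#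
  ∑-neg {suc n} f = trans (cong (- f zero +_) (∑-neg (f ∘ suc))) (-‿+-comm _ _)

  ∑-↑ : ∀ m {n} (f : Vector F (m ℕ.+ n)) → ∑ F f ≡ ∑ F (f ∘ (_↑ˡ n)) + ∑ F (f ∘ (m ↑ʳ_))
  ∑-↑ zero    f = sym (+-identityˡ _)
  ∑-↑ (suc m) f = trans (cong (f zero +_) (∑-↑ m (f ∘ suc))) (sym (+-assoc _ _ _))

  ∑-single : ∀ {n} (i : Fin n) (f : Vector F n) → (∀ j → j ≢ i → f j ≡ 0#) → ∑ F f ≡ f i
  ∑-single {suc n} i f vanishes = begin
    ∑ F f                      ≡⟨ ∑-punchIn i f ⟩
    f i + ∑ F (f ∘ punchIn i)  ≡⟨ cong (f i +_) (∑-cong (λ j → vanishes (punchIn i j) (Fin.punchInᵢ≢i i j))) ⟩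
    f i + ∑ F {n} (λ _ → 0#)   ≡⟨ cong (f i +_) (∑-zero n) ⟩
    f i + 0#                   ≡⟨ +-identityʳ _ ⟩
    f i                        ∎
    where open ≡-Reasoning

  infixl 6 _+ᵛ_
  infixr 7 _•_

  0ᵛ : ∀ {n} → Vector F n
  0ᵛ _ = 0#

  _+ᵛ_ : ∀ {n} → Vector F n → Vector F n → Vector F n
  (x +ᵛ y) j = x j + y j

  -ᵛ_ : ∀ {n} → Vector F n → Vector F n
  (-ᵛ x) j = - x j

  _•_ : ∀ {n} → Carrier → Vector F n → Vector F n
  (a • x) j = a * x j

  unit : ∀ {n} → Fin n → Vector F n
  unit i j with i Fin.≟ j
  ... | yes _ = 1#
  ... | no  _ = 0#

  unit-diag : ∀ {n} (i : Fin n) → unit i i ≡ 1#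
  unit-diag i with i Fin.≟ i
  ... | yes _   = refl
  ... | no  i≢i = ⊥-elim (i≢i refl)

  unit-off : ∀ {n} {i j : Fin n} → i ≢ j → unit i j ≡ 0#
  unit-off {i = i} {j} i≢j with i Fin.≟ j
  ... | yes i≡j = ⊥-elim (i≢j i≡j)
  ... | no  _   = refl

  ++-+ᵛ : ∀ {m n} (x x′ : Vector F m) (y y′ : Vector F n) →
          (x ++ y) +ᵛ (x′ ++ y′) ≗ (x +ᵛ x′) ++ (y +ᵛ y′)
  ++-+ᵛ {m} x x′ y y′ k with splitAt m k
  ... | inj₁ _ = refl
  ... | inj₂ _ = refl

  lincomb : ∀ {k n} → Vector F k → (Fin k → Vector F n) → Vector F n
  lincomb c v j = ∑ F (λ i → c i * v i j)

  lincomb-congˡ : ∀ {k n} {c c′ : Vector F k} (v : Fin k → Vector F n) → c ≗ c′ → lincomb c v ≗ lincomb c′ v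
  lincomb-congˡ v c≗c′ j = ∑-cong (λ i → cong (_* v i j) (c≗c′ i))

  lincomb-congʳ : ∀ {k n} (c : Vector F k) {v v′ : Fin k → Vector F n} →
                  (∀ i → v i ≗ v′ i) → lincomb c v ≗ lincomb c v′
  lincomb-congʳ c v≗v′ j = ∑-cong (λ i → cong (c i *_) (v≗v′ i j))

  lincomb-zeroˡ : ∀ {k n} (v : Fin k → Vector F n) → lincomb (λ _ → 0#) v ≗ 0ᵛ
  lincomb-zeroˡ {k} v j = trans (∑-cong (λ i → zeroˡ (v i j))) (∑-zero k)

  lincomb-zeroʳ : ∀ {k n} (c : Vector F k) → lincomb c (λ _ → 0ᵛ {n}) ≗ 0ᵛ
  lincomb-zeroʳ {k} c j = trans (∑-cong (λ i → zeroʳ (c i))) (∑-zero k)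

  lincomb-+ˡ : ∀ {k n} (c c′ : Vector F k) (v : Fin k → Vector F n) →
               lincomb (c +ᵛ c′) v ≗ lincomb c v +ᵛ lincomb c′ v
  lincomb-+ˡ c c′ v j = trans (∑-cong (λ i → distribʳ (v i j) (c i) (c′ i)))
                                (∑-+ (λ i → c i * v i j) (λ i → c′ i * v i j))

  lincomb-•ˡ : ∀ {k n} a (c : Vector F k) (v : Fin k → Vector F n) →
               lincomb (a • c) v ≗ a • lincomb c v
  lincomb-•ˡ a c v j = trans (∑-cong (λ i → *-assoc a (c i) (v i j))) (sym (*-∑ a (λ i → c i * v i j)))

  lincomb-negˡ : ∀ {k n} (c : Vector F k) (v : Fin k → Vector F n) →
                 lincomb (-ᵛ c) v ≗ -ᵛ lincomb c v
  lincomb-negˡ c v j = trans (∑-cong (λ i → sym (-‿distribˡ-* (c i) (v i j)))) (∑-neg (λ i → c i * v i j))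

  lincomb-+ʳ : ∀ {k n} (c : Vector F k) (v w : Fin k → Vector F n) →
               lincomb c (λ i → v i +ᵛ w i) ≗ lincomb c v +ᵛ lincomb c w
  lincomb-+ʳ c v w j = trans (∑-cong (λ i → distribˡ (c i) (v i j) (w i j)))
                                 (∑-+ (λ i → c i * v i j) (λ i → c i * w i j))

  lincomb-multiples : ∀ {k n} (c μ : Vector F k) (x : Vector F n) →
              lincomb c (λ i → μ i • x) ≗ ∑ F (λ i → c i * μ i) • x
  lincomb-multiples c μ x j =
    trans (∑-cong (λ i → sym (*-assoc (c i) (μ i) (x j)))) (sym (∑-* (x j) (λ i → c i * μ i)))

  lincomb-lincomb : ∀ {k l n} (c : Vector F k) (D : Fin k → Vector F l) (v : Fin l → Vector F n) →
                    lincomb c (λ i → lincomb (D i) v) ≗ lincomb (lincomb c D) v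
  lincomb-lincomb c D v j = begin
    ∑ F (λ i → c i * ∑ F (λ t → D i t * v t j))
      ≡⟨ ∑-cong (λ i → *-∑ (c i) (λ t → D i t * v t j)) ⟩
    ∑ F (λ i → ∑ F (λ t → c i * (D i t * v t j)))
      ≡⟨ ∑-cong (λ i → ∑-cong (λ t → sym (*-assoc (c i) (D i t) (v t j)))) ⟩
    ∑ F (λ i → ∑ F (λ t → c i * D i t * v t j))
      ≡⟨ ∑-∑-comm (λ i t → c i * D i t * v t j) ⟩
    ∑ F (λ t → ∑ F (λ i → c i * D i t * v t j))
      ≡⟨ ∑-cong (λ t → sym (∑-* (v t j) (λ i → c i * D i t))) ⟩
    ∑ F (λ t → lincomb c D t * v t j)
      ∎
    where open ≡-Reasoning

  lincomb-tail : ∀ {k n} (c : Vector F (suc k)) (v : Fin (suc k) → Vector F n) →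
                 c zero ≡ 0# → lincomb c v ≗ lincomb (c ∘ suc) (v ∘ suc)
  lincomb-tail c v c₀≡0 j = begin
    c zero * v zero j + rest  ≡⟨ cong (λ a → a * v zero j + rest) c₀≡0 ⟩
    0# * v zero j + rest      ≡⟨ cong (_+ rest) (zeroˡ (v zero j)) ⟩
    0# + rest                 ≡⟨ +-identityˡ rest ⟩
    rest                      ∎
    where
    open ≡-Reasoning
    rest = lincomb (c ∘ suc) (v ∘ suc) j

  lincomb-insertAt : ∀ {k n} (c : Vector F k) i a (v : Fin (suc k) → Vector F n) →
                     lincomb (insertAt c i a) v ≗ a • v i +ᵛ lincomb c (v ∘ punchIn i)
  lincomb-insertAt c i a v j = begin
    lincomb (insertAt c i a) v j
      ≡⟨ ∑-punchIn i (λ t → insertAt c i a t * v t j) ⟩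
    insertAt c i a i * v i j + ∑ F (λ t → insertAt c i a (punchIn i t) * v (punchIn i t) j)
      ≡⟨ cong₂ _+_ (cong (_* v i j) (insertAt-lookup c i a))
                   (∑-cong (λ t → cong (_* v (punchIn i t) j) (insertAt-punchIn c i a t))) ⟩
    a * v i j + lincomb c (v ∘ punchIn i) j
      ∎
    where open ≡-Reasoning

  lincomb-unitˡ : ∀ {k n} (i : Fin k) (v : Fin k → Vector F n) → lincomb (unit i) v ≗ v i
  lincomb-unitˡ i v j =
    trans (∑-single i _ (λ t t≢i → trans (cong (_* v t j) (unit-off (t≢i ∘ sym))) (zeroˡ _)))
          (trans (cong (_* v i j) (unit-diag i)) (*-identityˡ _))

  lincomb-unitʳ : ∀ {k} (c : Vector F k) → lincomb c unit ≗ c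
  lincomb-unitʳ c j =
    trans (∑-single j _ (λ t t≢j → trans (cong (c t *_) (unit-off t≢j)) (zeroʳ _)))
          (trans (cong (c j *_) (unit-diag j)) (*-identityʳ _))

  lincomb-↑ : ∀ {k l n} (c : Vector F (k ℕ.+ l)) (v : Fin k → Vector F n) (w : Fin l → Vector F n) →
              lincomb c (v ++ w) ≗ lincomb (c ∘ (_↑ˡ l)) v +ᵛ lincomb (c ∘ (k ↑ʳ_)) w
  lincomb-↑ {k} {l} c v w j = trans (∑-↑ k _) (cong₂ _+_
    (∑-cong (λ i → cong (λ x → c (i ↑ˡ l) * x j) (lookup-++ˡ v w i)))
    (∑-cong (λ i → cong (λ x → c (k ↑ʳ i) * x j) (lookup-++ʳ v w i))))

  lincomb-++ : ∀ {k m n} (c : Vector F k) (v : Fin k → Vector F m) (w : Fin k → Vector F n) →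
               lincomb c (λ i → v i ++ w i) ≗ lincomb c v ++ lincomb c w
  lincomb-++ {m = m} c v w j with splitAt m j
  ... | inj₁ _ = refl
  ... | inj₂ _ = refl

  Independent : ∀ {k n} → (Fin k → Vector F n) → Set
  Independent = LinearlyIndependent F

  InSpan : ∀ {k n} → (Fin k → Vector F n) → Vector F n → Set
  InSpan {k} v x = Σ (Vector F k) λ c → x ≗ lincomb c v

  InSpan? : ∀ {k n} (v : Fin k → Vector F n) x → Dec (InSpan v x)
  InSpan? {k} v x = ∃-Vector? k (λ c≗c′ x≗cv j → trans (x≗cv j) (lincomb-congˡ v c≗c′ j))
                                (λ c → Fin.all? (λ j → x j ≟ lincomb c v j))

  InSpan-resp : ∀ {k n} {v : Fin k → Vector F n} {x y} → x ≗ y → InSpan v x → InSpan v y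
  InSpan-resp x≗y (c , x≗cv) = c , λ j → trans (sym (x≗y j)) (x≗cv j)

  InSpan-member : ∀ {k n} (v : Fin k → Vector F n) i → InSpan v (v i)
  InSpan-member v i = unit i , λ j → sym (lincomb-unitˡ i v j)

  InSpan-zero : ∀ {k n} (v : Fin k → Vector F n) → InSpan v 0ᵛ
  InSpan-zero v = (λ _ → 0#) , λ j → sym (lincomb-zeroˡ v j)

  InSpan-neg : ∀ {k n} {v : Fin k → Vector F n} {x} → InSpan v x → InSpan v (-ᵛ x)
  InSpan-neg {v = v} (c , x≗cv) = -ᵛ c , λ j → trans (cong -_ (x≗cv j)) (sym (lincomb-negˡ c v j))

  InSpan-∷ : ∀ {k n} {v : Fin k → Vector F n} {x} y → InSpan v x → InSpan (y ∷ v) x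
  InSpan-∷ {v = v} y (c , x≗cv) = 0# ∷ c , λ j → trans (x≗cv j) (sym (lincomb-tail (0# ∷ c) (y ∷ v) refl j))

  InSpan-++ : ∀ {k l n} {v : Fin k → Vector F n} {w : Fin l → Vector F n} {x y} →
              InSpan v x → InSpan w y → InSpan (v ++ w) (x +ᵛ y)
  InSpan-++ {k} {l} {v = v} {w} {x} {y} (c , x≗cv) (d , y≗dw) = c ++ d , λ j → begin
    x j + y j
      ≡⟨ cong₂ _+_ (x≗cv j) (y≗dw j) ⟩
    lincomb c v j + lincomb d w j
      ≡⟨ cong₂ _+_ (lincomb-congˡ v (λ i → sym (lookup-++ˡ c d i)) j)
                   (lincomb-congˡ w (λ i → sym (lookup-++ʳ c d i)) j) ⟩
    lincomb ((c ++ d) ∘ (_↑ˡ l)) v j + lincomb ((c ++ d) ∘ (k ↑ʳ_)) w j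
      ≡⟨ lincomb-↑ (c ++ d) v w j ⟨
    lincomb (c ++ d) (v ++ w) j
      ∎
    where open ≡-Reasoning

  InSpan-trans : ∀ {k l n} {v : Fin k → Vector F n} {w : Fin l → Vector F n} {x} →
                 InSpan w x → (∀ i → InSpan v (w i)) → InSpan v x
  InSpan-trans {v = v} {w} (c , x≗cw) w⊆v = lincomb c D , λ j →
    trans (x≗cw j) (trans (lincomb-congʳ c (λ i → proj₂ (w⊆v i)) j) (lincomb-lincomb c D v j))
    where
    D = λ i → proj₁ (w⊆v i)

  Independent-resp : ∀ {k n} {x y : Fin k → Vector F n} → (∀ i → x i ≗ y i) → Independent x → Independent y
  Independent-resp x≗y x-indep c cy≗0 = x-indep c (λ j → trans (lincomb-congʳ c x≗y j) (cy≗0 j))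

  Independent-nonzero : ∀ {k n} {x : Fin k → Vector F n} → Independent x → ∀ i → ¬ (x i ≗ 0ᵛ)
  Independent-nonzero {x = x} x-indep i xᵢ≗0 = 0≢1 (trans (sym uᵢᵢ≡0) (unit-diag i))
    where
    uᵢᵢ≡0 = x-indep (unit i) (λ j → trans (lincomb-unitˡ i x j) (xᵢ≗0 j)) i

  Independent-tail : ∀ {k n} {x : Fin (suc k) → Vector F n} → Independent x → Independent (x ∘ suc)
  Independent-tail {x = x} x-indep c c·x≗0 i =
    x-indep (0# ∷ c) (λ j → trans (lincomb-tail (0# ∷ c) x refl j) (c·x≗0 j)) (suc i)

  Independent-∷ : ∀ {k n} {v : Fin k → Vector F n} {y} → Independent v → ¬ InSpan v y → Independent (y ∷ v)
  Independent-∷ {v = v} {y} v-indep y∉v c c·yv≗0 with c zero ≟ 0#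
  ... | yes c₀≡0 = λ where
    zero    → c₀≡0
    (suc i) → v-indep (c ∘ suc) (λ j → trans (sym (lincomb-tail c (y ∷ v) c₀≡0 j)) (c·yv≗0 j)) i
  ... | no c₀≢0 = ⊥-elim (y∉v ((- c₀⁻¹) • (c ∘ suc) , λ j →
          trans (solve-for (c·yv≗0 j)) (sym (lincomb-•ˡ (- c₀⁻¹) (c ∘ suc) v j))))
    where
    c₀⁻¹ = proj₁ (inverse (c zero) c₀≢0)
    c₀c₀⁻¹≡1 = proj₂ (inverse (c zero) c₀≢0)
    solve-for : ∀ {x w} → c zero * x + w ≡ 0# → x ≡ (- c₀⁻¹) * w
    solve-for {x} {w} eq = begin
      x                       ≡⟨ *-identityˡ x ⟨
      1# * x                  ≡⟨ cong (_* x) (trans (sym c₀c₀⁻¹≡1) (*-comm (c zero) c₀⁻¹)) ⟩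
      c₀⁻¹ * c zero * x       ≡⟨ *-assoc _ _ _ ⟩
      c₀⁻¹ * (c zero * x)     ≡⟨ cong (c₀⁻¹ *_) (+-inverseˡ-unique _ _ eq) ⟩
      c₀⁻¹ * - w              ≡⟨ -‿distribʳ-* _ _ ⟨
      - (c₀⁻¹ * w)            ≡⟨ -‿distribˡ-* _ _ ⟩
      (- c₀⁻¹) * w            ∎
      where open ≡-Reasoning

  Independent-shear : ∀ {k n} {x : Fin (suc k) → Vector F n} → Independent x →
                      ∀ i (μ : Vector F k) → Independent (λ j → x (punchIn i j) +ᵛ μ j • x i)
  Independent-shear {x = x} x-indep i μ c c·x′≗0 j =
    trans (sym (insertAt-punchIn c i s j)) (x-indep (insertAt c i s) relation (punchIn i j))
    where
    s = ∑ F (λ t → c t * μ t)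
    relation : lincomb (insertAt c i s) x ≗ 0ᵛ
    relation t = begin
      lincomb (insertAt c i s) x t
        ≡⟨ lincomb-insertAt c i s x t ⟩
      s * x i t + lincomb c (x ∘ punchIn i) t
        ≡⟨ +-comm _ _ ⟩
      lincomb c (x ∘ punchIn i) t + s * x i t
        ≡⟨ cong (lincomb c (x ∘ punchIn i) t +_) (lincomb-multiples c μ (x i) t) ⟨
      lincomb c (x ∘ punchIn i) t + lincomb c (λ j → μ j • x i) t
        ≡⟨ lincomb-+ʳ c (x ∘ punchIn i) (λ j → μ j • x i) t ⟨
      lincomb c (λ j → x (punchIn i j) +ᵛ μ j • x i) t
        ≡⟨ c·x′≗0 t ⟩
      0#
        ∎
      where open ≡-Reasoning

  cancel-pivot : ∀ a {g g⁻¹} → g * g⁻¹ ≡ 1# → a + (- (a * g⁻¹)) * g ≡ 0#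
  cancel-pivot a {g} {g⁻¹} gg⁻¹≡1 = begin
    a + (- (a * g⁻¹)) * g   ≡⟨ cong (a +_) (-‿distribˡ-* _ g) ⟨
    a + - (a * g⁻¹ * g)     ≡⟨ cong (λ t → a + - t) (*-assoc a g⁻¹ g) ⟩
    a + - (a * (g⁻¹ * g))   ≡⟨ cong (λ t → a + - (a * t)) (trans (*-comm g⁻¹ g) gg⁻¹≡1) ⟩
    a + - (a * 1#)          ≡⟨ cong (λ t → a + - t) (*-identityʳ a) ⟩
    a + - a                 ≡⟨ -‿inverseʳ a ⟩
    0#                      ∎
    where open ≡-Reasoning

  -- Either no x i involves y zero, or one that does serves as pivot to eliminate y zero from the others.
  exchange : ∀ {m n k} (x : Fin (suc m) → Vector F k) (y : Fin (suc n) → Vector F k)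
             (C : Fin (suc m) → Vector F (suc n)) → (∀ i → x i ≗ lincomb (C i) y) → Independent x →
             Σ (Fin m → Vector F k) λ x′ → Independent x′ × (∀ j → InSpan (y ∘ suc) (x′ j))
  exchange x y C x≗Cy x-indep with Fin.all? (λ i → C i zero ≟ 0#)
  ... | yes y₀-unused =
    x ∘ suc , Independent-tail {x = x} x-indep ,
    λ j → C (suc j) ∘ suc , λ t → trans (x≗Cy (suc j) t) (lincomb-tail (C (suc j)) y (y₀-unused (suc j)) t)
  ... | no y₀-used =
    x′ , Independent-shear {x = x} x-indep i₀ μ ,
    λ j → C′ j ∘ suc , λ t → trans (x′≗C′y j t) (lincomb-tail (C′ j) y (C′-pivot j) t)
    where
    pivot = Fin.¬∀⟶∃¬ _ (λ i → C i zero ≡ 0#) (λ i → C i zero ≟ 0#) y₀-used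
    i₀ = proj₁ pivot
    g⁻¹ = proj₁ (inverse (C i₀ zero) (proj₂ pivot))
    gg⁻¹≡1 = proj₂ (inverse (C i₀ zero) (proj₂ pivot))
    μ = λ j → - (C (punchIn i₀ j) zero * g⁻¹)
    x′ = λ j → x (punchIn i₀ j) +ᵛ μ j • x i₀
    C′ = λ j → C (punchIn i₀ j) +ᵛ μ j • C i₀
    x′≗C′y : ∀ j → x′ j ≗ lincomb (C′ j) y
    x′≗C′y j t = begin
      x (punchIn i₀ j) t + μ j * x i₀ t
        ≡⟨ cong₂ (λ a b → a + μ j * b) (x≗Cy (punchIn i₀ j) t) (x≗Cy i₀ t) ⟩
      lincomb (C (punchIn i₀ j)) y t + μ j * lincomb (C i₀) y t
        ≡⟨ cong (lincomb (C (punchIn i₀ j)) y t +_) (lincomb-•ˡ (μ j) (C i₀) y t) ⟨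
      lincomb (C (punchIn i₀ j)) y t + lincomb (μ j • C i₀) y t
        ≡⟨ lincomb-+ˡ (C (punchIn i₀ j)) (μ j • C i₀) y t ⟨
      lincomb (C′ j) y t
        ∎
      where open ≡-Reasoning
    C′-pivot : ∀ j → C′ j zero ≡ 0#
    C′-pivot j = cancel-pivot (C (punchIn i₀ j) zero) gg⁻¹≡1

  steinitz : ∀ {m n k} (x : Fin m → Vector F k) (y : Fin n → Vector F k) →
             Independent x → (∀ i → InSpan y (x i)) → m ≤ n
  steinitz {zero}          x y x-indep x⊆y = z≤n
  steinitz {suc m} {zero}  x y x-indep x⊆y =
    ⊥-elim (Independent-nonzero {x = x} x-indep zero (proj₂ (x⊆y zero)))
  steinitz {suc m} {suc n} x y x-indep x⊆y with exchange x y (proj₁ ∘ x⊆y) (λ i → proj₂ (x⊆y i)) x-indep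
  ... | x′ , x′-indep , x′⊆y = s≤s (steinitz x′ (y ∘ suc) x′-indep x′⊆y)

  record Basis {m n} (v : Fin m → Vector F n) : Set where
    field
      size        : ℕ
      index       : Fin size → Fin m
      injective   : Injective _≡_ _≡_ index
      independent : Independent (v ∘ index)
      spanning    : ∀ i → InSpan (v ∘ index) (v i)

  basis : ∀ {m n} (v : Fin m → Vector F n) → Basis v
  basis {zero} v = record
    { size = 0 ; index = λ () ; injective = λ {} ; independent = λ _ _ () ; spanning = λ () }
  basis {suc m} v with basis (v ∘ suc)
  ... | record { size = r ; index = σ ; injective = σ-inj ; independent = σ-indep ; spanning = σ-span }
      with InSpan? (v ∘ suc ∘ σ) (v zero)
  ...   | yes v₀∈ = record
    { size = r ; index = suc ∘ σ ; injective = σ-inj ∘ Fin.suc-injective ; independent = σ-indep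
    ; spanning = λ where
        zero    → v₀∈
        (suc i) → σ-span i
    }
  ...   | no v₀∉ = record
    { size = suc r ; index = zero ∷ (suc ∘ σ) ; injective = injective
    ; independent = Independent-∷ σ-indep v₀∉
    ; spanning = λ where
        zero    → InSpan-member (v zero ∷ (v ∘ suc ∘ σ)) zero
        (suc i) → InSpan-∷ (v zero) (σ-span i)
    }
    where
    injective : Injective _≡_ _≡_ (zero ∷ (suc ∘ σ))
    injective {zero}  {zero}  _  = refl
    injective {suc i} {suc j} eq = cong suc (σ-inj (Fin.suc-injective eq))

  RankAtLeast-resp : ∀ {m n r} {M M′ : Matrix F m n} →
                     (∀ i → M i ≗ M′ i) → RankAtLeast F M r → RankAtLeast F M′ r
  RankAtLeast-resp {M = M} M≗M′ (σ , σ-inj , σ-indep) =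
    σ , σ-inj , Independent-resp {x = M ∘ σ} (M≗M′ ∘ σ) σ-indep

  RankAtLeast-≤ : ∀ {m n d r} {M : Matrix F m n} → d ≤ r → RankAtLeast F M r → RankAtLeast F M d
  RankAtLeast-≤ {M = M} d≤r = drop (ℕ.≤⇒≤′ d≤r)
    where
    drop : ∀ {d r} → d ℕ.≤′ r → RankAtLeast F M r → RankAtLeast F M d
    drop ℕ.≤′-refl          rank = rank
    drop (ℕ.≤′-step d≤′r) (σ , σ-inj , σ-indep) =
      drop d≤′r (σ ∘ suc , Fin.suc-injective ∘ σ-inj , Independent-tail {x = M ∘ σ} σ-indep)

  RowSpaceDimAtLeast : ∀ {m n} → Matrix F m n → ℕ → Set
  RowSpaceDimAtLeast {n = n} A s = Σ (Fin s → Vector F n) λ x → Independent x × (∀ i → InSpan A (x i))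

  RankAtLeast⇒RowSpaceDimAtLeast : ∀ {m m′ n s} {M : Matrix F m n} {A : Matrix F m′ n} →
                                   (∀ i → InSpan A (M i)) → RankAtLeast F M s → RowSpaceDimAtLeast A s
  RankAtLeast⇒RowSpaceDimAtLeast {M = M} M⊆A (σ , _ , σ-indep) = M ∘ σ , σ-indep , M⊆A ∘ σ

  infixl 7 _ᵀ*_
  _ᵀ*_ : ∀ {p a b} → Matrix F p a → Matrix F p b → Matrix F a b
  (A ᵀ* B) ρ = lincomb (transpose A ρ) B

  ᵀ*-transpose : ∀ {p a b} (A : Matrix F p a) (B : Matrix F p b) ρ c → (A ᵀ* B) ρ c ≡ (B ᵀ* A) c ρ
  ᵀ*-transpose A B ρ c = ∑-cong (λ k → *-comm (A k ρ) (B k c))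

  rowRank≤columnRank : ∀ {p b s₂ s} {B : Matrix F p b} → RowSpaceDimAtLeast B s₂ →
                       (w : Fin s → Vector F p) → (∀ c → InSpan w (transpose B c)) → s₂ ≤ s
  rowRank≤columnRank {b = b} {s = s} {B} (h , h-indep , h⊆B) w columns⊆w =
    steinitz h z h-indep (λ i → InSpan-trans (h⊆B i) B⊆z)
    where
    z : Matrix F s b
    z i c = proj₁ (columns⊆w c) i
    B⊆z : ∀ k → InSpan z (B k)
    B⊆z k = transpose w k , λ c → trans (proj₂ (columns⊆w c) k) (ᵀ*-transpose z w c k)

  Independent-blockTriangular : ∀ {k l m n} {x : Fin k → Vector F m} {w : Fin l → Vector F n}
                                (g : Fin k → Vector F n) → Independent x → Independent w →
                                Independent ((λ i → x i ++ g i) ++ (λ j → 0ᵛ ++ w j))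
  Independent-blockTriangular {k} {l} {m} {n} {x} {w} g x-indep w-indep C C·X≗0 = ↑-elim c≡0 d≡0
    where
    c = C ∘ (_↑ˡ l)
    d = C ∘ (k ↑ʳ_)
    blocks : (lincomb c x +ᵛ lincomb d (λ _ → 0ᵛ)) ++ (lincomb c g +ᵛ lincomb d w) ≗ 0ᵛ
    blocks J = begin
      ((lincomb c x +ᵛ lincomb d (λ _ → 0ᵛ)) ++ (lincomb c g +ᵛ lincomb d w)) J
        ≡⟨ ++-+ᵛ (lincomb c x) (lincomb d (λ _ → 0ᵛ)) (lincomb c g) (lincomb d w) J ⟨
      (lincomb c x ++ lincomb c g) J + (lincomb d (λ _ → 0ᵛ) ++ lincomb d w) J
        ≡⟨ cong₂ _+_ (lincomb-++ c x g J) (lincomb-++ d (λ _ → 0ᵛ) w J) ⟨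
      lincomb c (λ i → x i ++ g i) J + lincomb d (λ j → 0ᵛ ++ w j) J
        ≡⟨ lincomb-↑ C (λ i → x i ++ g i) (λ j → 0ᵛ ++ w j) J ⟨
      lincomb C ((λ i → x i ++ g i) ++ (λ j → 0ᵛ ++ w j)) J
        ≡⟨ C·X≗0 J ⟩
      0# ∎
      where open ≡-Reasoning
    c≡0 : ∀ i → c i ≡ 0#
    c≡0 = x-indep c λ ρ → begin
      lincomb c x ρ                           ≡⟨ +-identityʳ _ ⟨
      lincomb c x ρ + 0#                      ≡⟨ cong (lincomb c x ρ +_) (lincomb-zeroʳ d ρ) ⟨
      lincomb c x ρ + lincomb d (λ _ → 0ᵛ) ρ  ≡⟨ lookup-++ˡ _ (lincomb c g +ᵛ lincomb d w) ρ ⟨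
      _                                       ≡⟨ blocks (ρ ↑ˡ n) ⟩
      0#                                      ∎
      where open ≡-Reasoning
    d≡0 : ∀ j → d j ≡ 0#
    d≡0 = w-indep d λ t → begin
      lincomb d w t                  ≡⟨ +-identityˡ _ ⟨
      0# + lincomb d w t             ≡⟨ cong (_+ lincomb d w t) (trans (lincomb-congˡ g c≡0 t) (lincomb-zeroˡ g t)) ⟨
      lincomb c g t + lincomb d w t  ≡⟨ lookup-++ʳ (lincomb c x +ᵛ lincomb d (λ _ → 0ᵛ)) _ t ⟨
      _                              ≡⟨ blocks (m ↑ʳ t) ⟩
      0#                             ∎
      where open ≡-Reasoning

  -- With x = rows of A (via coefficients g), E = coefficients of the rows of AᵀB over z, and
  -- B τ = independent columns of B, the s₁ + s vectors (x i , g i) and (0 , B τ l) are independent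
  -- and lie in the span of the p + r vectors (A k , unit k) and (E t , 0).
  sylvester : ∀ {p a b r s₁ s} (A : Matrix F p a) (B : Matrix F p b) (z : Fin r → Vector F b) →
              (∀ ρ → InSpan z ((A ᵀ* B) ρ)) → RowSpaceDimAtLeast A s₁ →
              (τ : Fin s → Fin b) → Independent (transpose B ∘ τ) → s₁ ℕ.+ s ≤ p ℕ.+ r
  sylvester {p} {a} {r = r} A B z M⊆z (x , x-indep , x⊆A) τ τ-indep =
    steinitz X Y (Independent-blockTriangular g x-indep τ-indep) (++⁺ (InSpan Y) x⊆Y column⊆Y)
    where
    g = λ i → proj₁ (x⊆A i)
    E : Matrix F r a
    E t ρ = proj₁ (M⊆z ρ) t
    X = (λ i → x i ++ g i) ++ (λ l → 0ᵛ ++ transpose B (τ l))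
    Y₁ = λ k → A k ++ unit k
    Y₂ = λ t → E t ++ 0ᵛ {p}
    Y = Y₁ ++ Y₂

    Y₁-span : ∀ c → lincomb c Y₁ ≗ lincomb c A ++ c
    Y₁-span c J =
      trans (lincomb-++ c A unit J) (++-cong (lincomb c A) (lincomb c A) (λ _ → refl) (lincomb-unitʳ c) J)

    Y₂-span : ∀ c → lincomb c Y₂ ≗ lincomb c E ++ 0ᵛ
    Y₂-span c J =
      trans (lincomb-++ c E (λ _ → 0ᵛ) J) (++-cong (lincomb c E) (lincomb c E) (λ _ → refl) (lincomb-zeroʳ c) J)

    x⊆Y : ∀ i → InSpan Y (x i ++ g i)
    x⊆Y i = InSpan-resp (λ J → +-identityʳ _) (InSpan-++ (g i , x⊆Y₁) (InSpan-zero Y₂))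
      where
      x⊆Y₁ : x i ++ g i ≗ lincomb (g i) Y₁
      x⊆Y₁ J = trans (++-cong (x i) (lincomb (g i) A) (proj₂ (x⊆A i)) (λ _ → refl) J) (sym (Y₁-span (g i) J))

    cancels : ∀ l → lincomb (transpose B (τ l)) A +ᵛ lincomb (-ᵛ transpose z (τ l)) E ≗ 0ᵛ
    cancels l ρ = begin
      (B ᵀ* A) (τ l) ρ + lincomb (-ᵛ transpose z (τ l)) E ρ
        ≡⟨ cong₂ _+_ (ᵀ*-transpose A B ρ (τ l)) (sym (lincomb-negˡ (transpose z (τ l)) E ρ)) ⟨
      (A ᵀ* B) ρ (τ l) + - (z ᵀ* E) (τ l) ρ
        ≡⟨ cong (λ t → (A ᵀ* B) ρ (τ l) + - t) (ᵀ*-transpose E z ρ (τ l)) ⟨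
      (A ᵀ* B) ρ (τ l) + - (E ᵀ* z) ρ (τ l)
        ≡⟨ cong (λ t → (A ᵀ* B) ρ (τ l) + - t) (proj₂ (M⊆z ρ) (τ l)) ⟨
      (A ᵀ* B) ρ (τ l) + - (A ᵀ* B) ρ (τ l)
        ≡⟨ -‿inverseʳ _ ⟩
      0#
        ∎
      where open ≡-Reasoning

    column⊆Y : ∀ l → InSpan Y (0ᵛ ++ transpose B (τ l))
    column⊆Y l = InSpan-resp rearrange
      (InSpan-++ (transpose B (τ l) , λ J → sym (Y₁-span (transpose B (τ l)) J))
                 (-ᵛ transpose z (τ l) , λ J → sym (Y₂-span (-ᵛ transpose z (τ l)) J)))
      where
      P = lincomb (transpose B (τ l)) A
      Q = lincomb (-ᵛ transpose z (τ l)) E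
      rearrange : (P ++ transpose B (τ l)) +ᵛ (Q ++ 0ᵛ) ≗ 0ᵛ ++ transpose B (τ l)
      rearrange J =
        trans (++-+ᵛ P Q (transpose B (τ l)) 0ᵛ J) (++-cong (P +ᵛ Q) 0ᵛ (cancels l) (λ k → +-identityʳ _) J)

  rank-ᵀ*-≥ : ∀ {p a b s₁ s₂ d} (A : Matrix F p a) (B : Matrix F p b) →
              RowSpaceDimAtLeast A s₁ → RowSpaceDimAtLeast B s₂ → d ℕ.+ p ≤ s₁ ℕ.+ s₂ →
              RankAtLeast F (A ᵀ* B) d
  rank-ᵀ*-≥ {p} {s₁ = s₁} {s₂} {d} A B dimA dimB bound =
    RankAtLeast-≤ {M = A ᵀ* B} d≤r (index rowBasis , injective rowBasis , independent rowBasis)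
    where
    open Basis
    rowBasis = basis (A ᵀ* B)
    columnBasis = basis (transpose B)
    r = size rowBasis
    s = size columnBasis
    s₂≤s : s₂ ≤ s
    s₂≤s = rowRank≤columnRank dimB (transpose B ∘ index columnBasis) (spanning columnBasis)
    s₁+s≤p+r : s₁ ℕ.+ s ≤ p ℕ.+ r
    s₁+s≤p+r = sylvester A B ((A ᵀ* B) ∘ index rowBasis) (spanning rowBasis) dimA
                         (index columnBasis) (independent columnBasis)
    d≤r : d ≤ r
    d≤r = ℕ.+-cancelʳ-≤ p d r (begin
      d ℕ.+ p   ≤⟨ bound ⟩
      s₁ ℕ.+ s₂ ≤⟨ ℕ.+-monoʳ-≤ s₁ s₂≤s ⟩
      s₁ ℕ.+ s  ≤⟨ s₁+s≤p+r ⟩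
      p ℕ.+ r   ≡⟨ ℕ.+-comm p r ⟩
      r ℕ.+ p   ∎)
      where open ℕ.≤-Reasoning

  rank-ᵀ*-≤ : ∀ {k a b} (G : Matrix F k a) (H : Matrix F k b) → RankAtMost F (G ᵀ* H) k
  rank-ᵀ*-≤ G H (σ , _ , σ-indep) =
    ℕ.1+n≰n (steinitz ((G ᵀ* H) ∘ σ) H σ-indep (λ t → transpose G (σ t) , λ _ → refl))

  negᴹ : ∀ {m n} → Matrix F m n → Matrix F m n
  negᴹ G i = -ᵛ G i

  ᵀ*-++ : ∀ {k l a b} (G : Matrix F k a) (G′ : Matrix F l a) (H : Matrix F k b) (H′ : Matrix F l b) ρ →
          ((G ++ G′) ᵀ* (H ++ H′)) ρ ≗ (G ᵀ* H) ρ +ᵛ (G′ ᵀ* H′) ρ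
  ᵀ*-++ G G′ H H′ ρ c = trans (lincomb-↑ (transpose (G ++ G′) ρ) H H′ c) (cong₂ _+_
    (lincomb-congˡ H (λ i → cong (λ row → row ρ) (lookup-++ˡ G G′ i)) c)
    (lincomb-congˡ H′ (λ j → cong (λ row → row ρ) (lookup-++ʳ G G′ j)) c))

  ᵀ*-difference : ∀ {k l a b} (G : Matrix F k a) (G′ : Matrix F l a) (H : Matrix F k b) (H′ : Matrix F l b) ρ →
                  _-ᴹ_ F (G ᵀ* H) (G′ ᵀ* H′) ρ ≗ ((G ++ negᴹ G′) ᵀ* (H ++ H′)) ρ
  ᵀ*-difference G G′ H H′ ρ c = trans
    (cong ((G ᵀ* H) ρ c +_) (sym (lincomb-negˡ (transpose G′ ρ) H′ c)))
    (sym (ᵀ*-++ G (negᴹ G′) H H′ ρ c))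

  stack≡++ : ∀ {k l n} (G : Matrix F k n) (H : Matrix F l n) i → stack F G H i ≡ (G ++ H) i
  stack≡++ {k} G H i with splitAt k i
  ... | inj₁ _ = refl
  ... | inj₂ _ = refl

  stack⊆++ : ∀ {k l n} (G : Matrix F k n) (H : Matrix F l n) i → InSpan (G ++ H) (stack F G H i)
  stack⊆++ G H i = subst (InSpan (G ++ H)) (sym (stack≡++ G H i)) (InSpan-member (G ++ H) i)

  stack⊆++negᴹ : ∀ {k l n} (G : Matrix F k n) (G′ : Matrix F l n) i → InSpan (G ++ negᴹ G′) (stack F G G′ i)
  stack⊆++negᴹ {k} {l} G G′ i = subst (InSpan A) (sym (stack≡++ G G′ i)) (++⁺ (InSpan A) G⊆A G′⊆A i)
    where
    A = G ++ negᴹ G′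
    G⊆A : ∀ i → InSpan A (G i)
    G⊆A i = subst (InSpan A) (lookup-++ˡ G (negᴹ G′) i) (InSpan-member A (i ↑ˡ l))
    G′⊆A : ∀ j → InSpan A (G′ j)
    G′⊆A j = InSpan-resp (λ ρ → -‿involutive (G′ j ρ))
               (InSpan-neg (subst (InSpan A) (lookup-++ʳ G (negᴹ G′) j) (InSpan-member A (k ↑ʳ j))))

  productCode : ∀ {a b d d₁ d₂ u n} → 2 ℕ.* d ≤ d₁ ℕ.+ d₂ →
                ConstantDimCode F a d₁ u n → ConstantDimCode F b d₂ u n → RankMetricCode F a b d u n
  productCode {d = d} {d₁} {d₂} {u} 2d≤d₁+d₂ (U , U-far) (W , W-far) = X , X-far , X-rank
    where
    G = λ i → proj₁ (U i)
    H = λ i → proj₁ (W i)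
    X = λ i → G i ᵀ* H i
    X-rank : ∀ i → RankAtMost F (X i) u
    X-rank i = rank-ᵀ*-≤ (G i) (H i)
    X-far : ∀ i j → i ≢ j → RankAtLeast F (_-ᴹ_ F (X i) (X j)) _
    X-far i j i≢j with U-far i j i≢j | W-far i j i≢j
    ... | s₁ , rank₁ , bound₁ | s₂ , rank₂ , bound₂ =
      RankAtLeast-resp (λ ρ c → sym (ᵀ*-difference (G i) (G j) (H i) (H j) ρ c))
        (rank-ᵀ*-≥ (G i ++ negᴹ (G j)) (H i ++ H j)
          (RankAtLeast⇒RowSpaceDimAtLeast (stack⊆++negᴹ (G i) (G j)) rank₁)
          (RankAtLeast⇒RowSpaceDimAtLeast (stack⊆++ (H i) (H j)) rank₂)
          (distance-bound d d₁ d₂ u s₁ s₂ 2d≤d₁+d₂ bound₁ bound₂))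

  ConstantDimCode-restrict : ∀ {v d k m n} → m ≤ n → ConstantDimCode F v d k n → ConstantDimCode F v d k m
  ConstantDimCode-restrict m≤n (U , U-far) =
    U ∘ inject , λ i j i≢j → U-far (inject i) (inject j) (i≢j ∘ Fin.inject≤-injective m≤n m≤n i j)
    where
    inject = λ i → Fin.inject≤ i m≤n

open import Data.Nat using (_+_; _*_; _⊓_)

theorem15 : (q : ℕ) → IsPrimePower q → (F : FiniteField q) →
    (a b d d₁ d₂ u : ℕ) → 1 ≤ a → 1 ≤ b → 1 ≤ d → 1 ≤ d₁ → 1 ≤ d₂ → 1 ≤ u →
    2 * d ≤ d₁ + d₂ →
    (n₁ n₂ : ℕ) → ConstantDimCode F a d₁ u n₁ → ConstantDimCode F b d₂ u n₂ →
    RankMetricCode F a b d u (n₁ ⊓ n₂)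
theorem15 q _ F a b d d₁ d₂ u _ _ _ _ _ _ 2d≤d₁+d₂ n₁ n₂ C₁ C₂ =
  productCode {d = d} {d₁} {d₂} 2d≤d₁+d₂
    (ConstantDimCode-restrict {d = d₁} (ℕ.m⊓n≤m n₁ n₂) C₁)
    (ConstantDimCode-restrict {d = d₂} (ℕ.m⊓n≤n n₁ n₂) C₂)
  where open LinearAlgebra F
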